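{- Let $\mathfrak{T}=(T;<)$ be a tree, and let $F_T$, $F_T^\dagger$ and $\sigma$ be as described in the context. Then for every path $P$ in $\mathfrak{T}$ and every $<$-component $\mathfrak{T}^*$ of the forest $(F_T;\subset)$ there exists a path $\tilde P$ in $\mathfrak{T}^*$ such that $\sigma(\tilde P)=P$. Likewise, for every path $P$ in $\mathfrak{T}$ and every $<$-component $\mathfrak{T}^*$ of the forest $(F_T^\dagger;\subset)$ there exists a path $\tilde P$ in $\mathfrak{T}^*$ with $\sigma(\tilde P)=P$.
   Context: A forest is a strict partial order $(F;<)$ such that for every $x$ the set $\{y:y<x\}$ is linearly ordered; a tree is a forest that is downward-connected: for all $x,y$ there is $z$ with $z\leqslant x$ and $z\leqslant y$. Trees are not assumed well-founded or rooted. A path is a maximal linearly ordered subset. A bridge is a nonempty convex linearly ordered set $B$ of nodes (convex: $x<z<y$, $x,y\in B$ imply $z\in B$) such that for every path $P$, either $B\subseteq P$ or $B\cap P=\emptyset$; a maximal bridge is one maximal under inclusion. A $<$-component of a forest $(F;<)$ is a nonempty set $C\subseteq F$ such that (i) if $t\in C$, $t'\leqslant t$ and $t'\leqslant u$ then $u\in C$, and (ii) $C$ is minimal under inclusion with property (i); the $<$-components are subtrees. For $t\in T$ let $T^{\leqslant t}=\{x:x\leqslant t\}$; $F_T=\bigcup\{2^{T^{\leqslant t}}:t\in T\}$ where $2^X$ is the set of functions $X\to\{0,1\}$; $F_T^\dagger$ is the set of $f\in F_T$ with $f(t)=1$ for every $t$ in the domain of $f$ that is the least node of a maximal bridge of $\mathfrak{T}$.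 Both are ordered by $\subset$: $f\subset g$ iff $g$ properly extends $f$; both $(F_T;\subset)$ and $(F_T^\dagger;\subset)$ are forests. The map $\sigma:F_T\to T$ is given by $\sigma(f)=t$ for $f\in 2^{T^{\leqslant t}}$. -}

module Defs where

open import Level using (Level; _⊔_; 0ℓ) renaming (suc to lsuc)
open import Data.Bool using (Bool; true)
open import Data.Product using (Σ; ∃; _×_; _,_; proj₁; proj₂)
open import Data.Sum using (_⊎_)
open import Data.Empty using (⊥)
open import Relation.Unary using (Pred; _⊆_)
open import Relation.Binary.PropositionalEquality using (_≡_)
open import Relation.Binary.Structures using (IsStrictPartialOrder)
open import Function.Bundles using (_⇔_)

module Order {a e r : Level} {A : Set a}
             (_≈_ : A → A → Set e) (_<_ : A → A → Set r) where

  _≤_ : A → A → Set (e ⊔ r)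
  x ≤ y = (x < y) ⊎ (x ≈ y)

  Comparable : A → A → Set (e ⊔ r)
  Comparable x y = (x < y) ⊎ (x ≈ y) ⊎ (y < x)

  IsChain : {ℓ : Level} → Pred A ℓ → Set (a ⊔ e ⊔ r ⊔ ℓ)
  IsChain S = ∀ x y → S x → S y → Comparable x y

  IsPathIn : {ℓ : Level} → Pred A ℓ → Pred A ℓ → Set (a ⊔ e ⊔ r ⊔ lsuc ℓ)
  IsPathIn {ℓ} C S =
    (S ⊆ C) × IsChain S ×
    (∀ (S' : Pred A ℓ) → S' ⊆ C → IsChain S' → S ⊆ S' → S' ⊆ S)

  IsPath : {ℓ : Level} → Pred A ℓ → Set (a ⊔ e ⊔ r ⊔ lsuc ℓ)
  IsPath {ℓ} S =
    IsChain S × (∀ (S' : Pred A ℓ) → IsChain S' → S ⊆ S' → S' ⊆ S)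

  Nonempty : {ℓ : Level} → Pred A ℓ → Set (a ⊔ ℓ)
  Nonempty S = ∃ λ x → S x

  ComponentClosed : {ℓ : Level} → Pred A ℓ → Set (a ⊔ e ⊔ r ⊔ ℓ)
  ComponentClosed C = ∀ t t' u → C t → t' ≤ t → t' ≤ u → C u

  IsComponent : {ℓ : Level} → Pred A ℓ → Set (a ⊔ e ⊔ r ⊔ lsuc ℓ)
  IsComponent {ℓ} C =
    Nonempty C × ComponentClosed C ×
    (∀ (C' : Pred A ℓ) → Nonempty C' → ComponentClosed C' → C' ⊆ C → C ⊆ C')

  Convex : {ℓ : Level} → Pred A ℓ → Set (a ⊔ r ⊔ ℓ)
  Convex B = ∀ x y z → B x → B y → x < z → z < y → B z

record Tree : Set₁ where
  field
    Carrier : Set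
    _<_     : Carrier → Carrier → Set
    isStrictPartialOrder : IsStrictPartialOrder _≡_ _<_
  open Order {A = Carrier} _≡_ _<_ public
  field
    predLinear : ∀ x y z → y < x → z < x → Comparable y z
    downConnected : ∀ x y → ∃ λ z → (z ≤ x) × (z ≤ y)

module TreeNotions (𝔗 : Tree) where
  open Tree 𝔗

  T : Set
  T = Carrier

  IsBridge : Pred T 0ℓ → Set₁
  IsBridge B =
    Nonempty B × Convex B × IsChain B ×
    (∀ (P : Pred T 0ℓ) → IsPath P → (B ⊆ P) ⊎ (∀ x → B x → P x → ⊥))

  IsMaximalBridge : Pred T 0ℓ → Set₁
  IsMaximalBridge B =
    IsBridge B × (∀ (B' : Pred T 0ℓ) → IsBridge B' → B ⊆ B' → B' ⊆ B)

  IsLeastOfMaximalBridge : T → Set₁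
  IsLeastOfMaximalBridge t =
    Σ (Pred T 0ℓ) λ B → IsMaximalBridge B × B t × (∀ y → B y → t ≤ y)

  -- An element of 2^{T^{≤t}} is represented by (t , f) with
  -- f : T → Bool, two representatives being equal iff they have the
  -- same t and agree on T^{≤t} (setoid encoding of the restriction).

  F : Set
  F = Σ T (λ _ → T → Bool)

  σ : F → T
  σ = proj₁

  _≈F_ : F → F → Set
  (s , f) ≈F (t , g) = (s ≡ t) × (∀ x → x ≤ s → f x ≡ g x)

  _⊂F_ : F → F → Set
  (s , f) ⊂F (t , g) = (s < t) × (∀ x → x ≤ s → f x ≡ g x)

  Dagger : F → Set₁
  Dagger (s , f) = ∀ x → x ≤ s → IsLeastOfMaximalBridge x → f x ≡ true

  F† : Set₁
  F† = Σ F Dagger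

  σ† : F† → T
  σ† φ = σ (proj₁ φ)

  _≈F†_ : F† → F† → Set
  φ ≈F† ψ = proj₁ φ ≈F proj₁ ψ

  _⊂F†_ : F† → F† → Set
  φ ⊂F† ψ = proj₁ φ ⊂F proj₁ ψ

  ImageIs : {a : Level} {A : Set a} → (A → T) → Pred A 0ℓ → Pred T 0ℓ → Set a
  ImageIs s S P = ∀ t → P t ⇔ (∃ λ φ → S φ × (s φ ≡ t))

  module OF  = Order _≈F_ _⊂F_
  module OF† = Order _≈F†_ _⊂F†_

{-# OPTIONS --safe #-}
-- Fix a global colouring G : T → Bool. Over a path P the restrictions G|T^{≤t}, t ∈ P, form
-- a chain of F_T. It lies in every <-component containing an element compatible with G, since
-- that element and G|T^{≤t} have the common lower bound G|T^{≤z} (downward connectedness).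
-- It is maximal: an element comparable with all of it lies over a node comparable with all
-- of P, hence in P, and is then forced to be the restriction of G to that node. For F_T^† take
-- G extending a given element and equal to 1 off its domain (this needs excluded middle), so
-- that all restrictions of G are in F_T^†. Only nonemptiness and property (i) of the component
-- are used.
module Submission where

open import Defs
open import Level using (Level; 0ℓ; suc; lift; lower)
open import Data.Bool using (Bool; true)
open import Data.Product using (∃; _×_; _,_; proj₁; proj₂)
open import Data.Sum using (_⊎_; inj₁; inj₂)
open import Function using (_∘_; id)
open import Function.Bundles using (mk⇔)
open import Relation.Unary using (Pred; _⊆_)
open import Relation.Nullary using (Dec; yes; no; contradiction)
open import Relation.Nullary.Decidable using (map′)
open import Relation.Binary.PropositionalEquality using (_≡_; refl; sym; trans; cong; subst)
open import Relation.Binary.Structures using (IsStrictPartialOrder; IsPartialOrder)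
open import Relation.Binary.Construct.StrictToNonStrict using (isPartialOrder)
open import Axiom.ExcludedMiddle using (ExcludedMiddle)

module _ (𝔗 : Tree) where
  open Tree 𝔗
  open TreeNotions 𝔗
  open IsStrictPartialOrder isStrictPartialOrder using (irrefl) renaming (trans to <-trans)
  open IsPartialOrder (isPartialOrder _≡_ _<_ isStrictPartialOrder) using ()
    renaming (trans to ≤-trans)

  ≤-<-trans : ∀ {x y z} → x ≤ y → y < z → x < z
  ≤-<-trans (inj₁ x<y) y<z = <-trans x<y y<z
  ≤-<-trans (inj₂ refl) y<z = y<z

  comparable-sym : ∀ {x y} → Comparable x y → Comparable y x
  comparable-sym (inj₁ x<y)        = inj₂ (inj₂ x<y)
  comparable-sym (inj₂ (inj₁ x≡y)) = inj₂ (inj₁ (sym x≡y))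
  comparable-sym (inj₂ (inj₂ y<x)) = inj₁ y<x

  comparable-with-path⇒∈ : ∀ {P : Pred T 0ℓ} → IsPath P →
    ∀ t → (∀ p → P p → Comparable p t) → P t
  comparable-with-path⇒∈ {P} (P-chain , P-maximal) t t-comparable =
    P-maximal P∪t P∪t-chain inj₁ (inj₂ refl)
    where
    P∪t : Pred T 0ℓ
    P∪t x = P x ⊎ x ≡ t
    P∪t-chain : IsChain P∪t
    P∪t-chain x y (inj₁ px)   (inj₁ py)   = P-chain x y px py
    P∪t-chain x y (inj₁ px)   (inj₂ refl) = t-comparable x px
    P∪t-chain x y (inj₂ refl) (inj₁ py)   = comparable-sym (t-comparable y py)
    P∪t-chain x y (inj₂ refl) (inj₂ refl) = inj₂ (inj₁ refl)

  AgreeBelow : (T → Bool) → (T → Bool) → T → Set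
  AgreeBelow g h t = ∀ x → x ≤ t → g x ≡ h x

  restriction-≤F : ∀ {s t g h} → s ≤ t → AgreeBelow g h s → OF._≤_ (s , g) (t , h)
  restriction-≤F (inj₁ s<t) g≈h = inj₁ (s<t , g≈h)
  restriction-≤F (inj₂ s≡t) g≈h = inj₂ (s≡t , g≈h)

  σ-comparable : ∀ {φ ψ} → OF.Comparable φ ψ → Comparable (σ φ) (σ ψ)
  σ-comparable (inj₁ (s<t , _))        = inj₁ s<t
  σ-comparable (inj₂ (inj₁ (s≡t , _))) = inj₂ (inj₁ s≡t)
  σ-comparable (inj₂ (inj₂ (t<s , _))) = inj₂ (inj₂ t<s)

  comparable-over-same-node : ∀ {t g h} → OF.Comparable (t , g) (t , h) → AgreeBelow g h t
  comparable-over-same-node (inj₁ (t<t , _))        = contradiction t<t (irrefl refl)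
  comparable-over-same-node (inj₂ (inj₁ (_ , g≈h))) = g≈h
  comparable-over-same-node (inj₂ (inj₂ (t<t , _))) = contradiction t<t (irrefl refl)

  agree-through : ∀ {s t g h G} → s ≤ t → AgreeBelow g G s → AgreeBelow h G t → AgreeBelow g h s
  agree-through s≤t g≈G h≈G x x≤s = trans (g≈G x x≤s) (sym (h≈G x (≤-trans x≤s s≤t)))

  Branch : Pred T 0ℓ → (T → Bool) → Pred F 0ℓ
  Branch P G (t , h) = P t × AgreeBelow h G t

  Branch-isChain : ∀ {P} → IsChain P → ∀ G → OF.IsChain (Branch P G)
  Branch-isChain P-chain G (s , g) (t , h) (ps , g≈G) (pt , h≈G) with P-chain s t ps pt
  ... | inj₁ s<t         = inj₁ (s<t , agree-through (inj₁ s<t) g≈G h≈G)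
  ... | inj₂ (inj₁ refl) = inj₂ (inj₁ (refl , agree-through (inj₂ refl) g≈G h≈G))
  ... | inj₂ (inj₂ t<s)  = inj₂ (inj₂ (t<s , agree-through (inj₁ t<s) h≈G g≈G))

  -- The order of F is pulled back along π; OF and OF† are the instances π = id and π = proj₁.
  module Pullback {a : Level} {A : Set a} (π : A → F)
                  (G : T → Bool) (restrict : T → A) (π-restrict : ∀ t → π (restrict t) ≡ (t , G)) where
    module OA = Order (λ φ ψ → π φ ≈F π ψ) (λ φ ψ → π φ ⊂F π ψ)

    Branchᴬ : Pred T 0ℓ → Pred A 0ℓ
    Branchᴬ P = Branch P G ∘ π

    restrict-∈-Branchᴬ : ∀ P {t} → P t → Branchᴬ P (restrict t)
    restrict-∈-Branchᴬ P {t} pt = subst (Branch P G) (sym (π-restrict t)) (pt , λ _ _ → refl)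

    Branchᴬ-isPathIn : ∀ {P C} → IsPath P → OA.ComponentClosed C →
      ∀ {c} → C c → AgreeBelow (proj₂ (π c)) G (σ (π c)) → OA.IsPathIn C (Branchᴬ P)
    Branchᴬ-isPathIn {P} {C} P-path C-closed {c} c∈C c≈G = ⊆C , chain , maximal
      where
      ⊆C : ∀ {φ} → Branchᴬ P φ → C φ
      ⊆C {φ} (_ , φ≈G) with downConnected (σ (π c)) (σ (π φ))
      ... | z , z≤c , z≤φ = C-closed c (restrict z) φ c∈C
        (subst (λ ψ → OF._≤_ ψ (π c)) (sym (π-restrict z))
          (restriction-≤F z≤c (agree-through z≤c (λ _ _ → refl) c≈G)))
        (subst (λ ψ → OF._≤_ ψ (π φ)) (sym (π-restrict z))
          (restriction-≤F z≤φ (agree-through z≤φ (λ _ _ → refl) φ≈G)))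

      chain : OA.IsChain (Branchᴬ P)
      chain φ ψ = Branch-isChain (proj₁ P-path) G (π φ) (π ψ)

      -- φ is comparable with restrict p for every p ∈ P, so σ φ ∈ P; comparing φ with
      -- restrict (σ φ), which lies over the same node, forces φ to agree with G.
      maximal : ∀ S → S ⊆ C → OA.IsChain S → Branchᴬ P ⊆ S → S ⊆ Branchᴬ P
      maximal S _ S-chain Branch⊆S {φ} φ∈S =
        σφ∈P , comparable-over-same-node (comparable-with-restrict σφ∈P)
        where
        comparable-with-restrict : ∀ {p} → P p → OF.Comparable (π φ) (p , G)
        comparable-with-restrict {p} pp = subst (OF.Comparable (π φ)) (π-restrict p)
          (S-chain φ (restrict p) φ∈S (Branch⊆S (restrict-∈-Branchᴬ P pp)))
        σφ∈P : P (σ (π φ))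
        σφ∈P = comparable-with-path⇒∈ P-path (σ (π φ))
          λ p pp → comparable-sym (σ-comparable (comparable-with-restrict pp))

    Branchᴬ-image : ∀ P → ImageIs (σ ∘ π) (Branchᴬ P) P
    Branchᴬ-image P t = mk⇔
      (λ pt → restrict t , restrict-∈-Branchᴬ P pt , cong σ (π-restrict t))
      (λ { (φ , (pφ , _) , σφ≡t) → subst P σφ≡t pφ })

  dagger-extension : ExcludedMiddle (suc 0ℓ) → (φ : F†) →
    ∃ λ G → AgreeBelow (proj₂ (proj₁ φ)) G (σ† φ) × (∀ t → Dagger (t , G))
  dagger-extension em ((s , g) , g-dagger) = G , g≈G , G-dagger
    where
    below? : ∀ x → Dec (x ≤ s)
    below? x = map′ lower lift em

    G : T → Bool
    G x with below? x
    ... | yes _ = g x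
    ... | no _  = true

    g≈G : AgreeBelow g G s
    g≈G x x≤s with below? x
    ... | yes _   = refl
    ... | no x≰s = contradiction x≤s x≰s

    G-dagger : ∀ t → Dagger (t , G)
    G-dagger t x _ x-least with below? x
    ... | yes x≤s = g-dagger x x≤s x-least
    ... | no _    = refl

  F-path-over : ∀ P → IsPath P → ∀ C → OF.IsComponent C →
    ∃ λ P̃ → OF.IsPathIn C P̃ × ImageIs σ P̃ P
  F-path-over P P-path C (((s , g) , c∈C) , C-closed , _) =
    Branchᴬ P , Branchᴬ-isPathIn P-path C-closed c∈C (λ _ _ → refl) , Branchᴬ-image P
    where open Pullback id g (_, g) (λ _ → refl)

  F†-path-over : ExcludedMiddle (suc 0ℓ) → ∀ P → IsPath P → ∀ C → OF†.IsComponent C →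
    ∃ λ P̃ → OF†.IsPathIn C P̃ × ImageIs σ† P̃ P
  F†-path-over em P P-path C ((c , c∈C) , C-closed , _) with dagger-extension em c
  ... | G , c≈G , G-dagger =
    Branchᴬ P , Branchᴬ-isPathIn P-path C-closed c∈C c≈G , Branchᴬ-image P
    where open Pullback {A = F†} proj₁ G (λ t → (t , G) , G-dagger t) (λ _ → refl)

lemma5p5 : ExcludedMiddle (suc 0ℓ) → (𝔗 : Tree) →
    (∀ (P : Pred (TreeNotions.T 𝔗) 0ℓ) → Tree.IsPath 𝔗 P →
    ∀ (C : Pred (TreeNotions.F 𝔗) 0ℓ) → TreeNotions.OF.IsComponent 𝔗 C →
    ∃ λ (P̃ : Pred (TreeNotions.F 𝔗) 0ℓ) →
    TreeNotions.OF.IsPathIn 𝔗 C P̃ × TreeNotions.ImageIs 𝔗 (TreeNotions.σ 𝔗) P̃ P)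
    × (∀ (P : Pred (TreeNotions.T 𝔗) 0ℓ) → Tree.IsPath 𝔗 P →
    ∀ (C : Pred (TreeNotions.F† 𝔗) 0ℓ) → TreeNotions.OF†.IsComponent 𝔗 C →
    ∃ λ (P̃ : Pred (TreeNotions.F† 𝔗) 0ℓ) →
    TreeNotions.OF†.IsPathIn 𝔗 C P̃ × TreeNotions.ImageIs 𝔗 (TreeNotions.σ† 𝔗) P̃ P)
lemma5p5 em 𝔗 = F-path-over 𝔗 , F†-path-over 𝔗 em
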